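{- Let $n \geq 0$, let $B \subseteq 2^n$ be a set of leaves, and let $\ddot B$ be its normalization, defined as in the context with respect to any enumeration $(a_i : i < N)$ of $2^{<n}$ in which longer sequences come first. Then \[ \mathrm{TD}(B) = \|\ddot B\|. \]
   Context: Nodes are binary sequences of length at most $n$ (the set $2^{\leq n}$), and $2^{<n}$ denotes the binary sequences of length less than $n$. Leaves are elements of $2^n$. Write $a \prec b$ if $a$ is a proper initial segment of $b$. For $B \subseteq 2^n$, $\check B$ is the set of all initial segments, including the sequences themselves, of elements of $B$. The binary tree of height $d$ is $T_d = (2^{\leq d}, \prec)$. An embedding of $(A,\prec)$ into $(A',\prec)$ is an injective map $f$ such that $a \prec a'$ iff $f(a) \prec f(a')$. For nonempty $B \subseteq 2^n$, the tree dimension $\mathrm{TD}(B)$ is the largest nonnegative integer $d$ such that $T_d$ embeds in $(\check B, \prec)$. Set $\mathrm{TD}(\emptyset) = -1$. Norms: for a node $a$, $\|a\| = \sum_{i<|a|} a(i)$, the number of $1$'s in $a$. For a nonempty set of nodes $A$, $\|A\| = \max_{a \in A}\|a\|$, and $\|\emptyset\| = -1$. Swaps: for $a \in 2^{<n}$, $\sigma_a$ is the map on $2^{\leq n}$ with $a^\frown 0^\frown b \mapsto a^\frown 1^\frown b$ and $a^\frown 1^\frown b \mapsto a^\frown 0^\frown b$ for every sequence $b$ of length at most $n-|a|-1$. It fixes all other nodes. For a set of nodes $A$, $A{\restriction}_a$ is the set of elements of $A$ having $a$ as an initial segment. Normalization: let $N = 2^{n-1} + \cdots + 2^0$, and let $(a_i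 : i < N)$ enumerate $2^{<n}$ so that $|a_i| > |a_j|$ implies $i < j$. Put $B_0 = B$. For $i < N$, set $B_{i+1} = B_i$ if $\|B_i{\restriction}_{a_i}\| \leq \|\sigma_{a_i}(B_i{\restriction}_{a_i})\|$, and otherwise $B_{i+1} = \sigma_{a_i}(B_i)$. Finally $\ddot B = B_N$. -}

module Defs where

open import Data.Bool using (Bool; true; false; not; if_then_else_; _xor_)
open import Data.Nat as ℕ using (ℕ; zero; suc)
open import Data.Integer as ℤ using (ℤ; +_; -[1+_]; _⊔_; _≤ᵇ_)
open import Data.List using (List; []; _∷_; _++_; map; filterᵇ; foldl; foldr; length; lookup)
open import Data.List.Membership.Propositional using (_∈_)
open import Data.List.Relation.Unary.Any using (Any)
open import Data.List.Relation.Unary.Unique.Propositional using (Unique)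
open import Data.Fin as Fin using (Fin)
open import Data.Product using (Σ; _×_; _,_)
open import Data.Sum using (_⊎_)
open import Function.Bundles using (_⇔_)
open import Relation.Nullary using (¬_; does)
open import Relation.Binary.PropositionalEquality using (_≡_)

Node : Set
Node = List Bool

_⊑_ : Node → Node → Set
a ⊑ b = Σ Node λ c → b ≡ a ++ c

_≺_ : Node → Node → Set
a ≺ b = Σ Node λ c → (¬ c ≡ []) × (b ≡ a ++ c)

isPrefixᵇ : Node → Node → Bool
isPrefixᵇ [] _ = true
isPrefixᵇ (_ ∷ _) [] = false
isPrefixᵇ (c ∷ a) (d ∷ x) = if c xor d then false else isPrefixᵇ a x

‖_‖ : Node → ℕ
‖ [] ‖ = 0
‖ true ∷ a ‖ = suc ‖ a ‖
‖ false ∷ a ‖ = ‖ a ‖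

normSet : List Node → ℤ
normSet = foldr (λ a m → (+ ‖ a ‖) ⊔ m) -[1+ 0 ]

-- The swap σ_a : a⁀i⁀b ↦ a⁀(1-i)⁀b, fixing all other nodes.
swap : Node → Node → Node
swap [] [] = []
swap [] (b ∷ x) = not b ∷ x
swap (_ ∷ _) [] = []
swap (c ∷ a) (d ∷ x) = if c xor d then d ∷ x else d ∷ swap a x

restrict : Node → List Node → List Node
restrict a A = filterᵇ (isPrefixᵇ a) A

step : List Node → Node → List Node
step B a =
  if normSet (restrict a B) ≤ᵇ normSet (map (swap a) (restrict a B))
  then B else map (swap a) B

normalize : List Node → List Node → List Node
normalize as B = foldl step B as

-- as enumerates 2^{<n} (each exactly once), longer sequences first.
IsEnumeration : ℕ → List Node → Set
IsEnumeration n as =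
  Unique as
  × (∀ (a : Node) → (a ∈ as) ⇔ (length a ℕ.< n))
  × (∀ (i j : Fin (length as)) →
       length (lookup as j) ℕ.< length (lookup as i) → i Fin.< j)

-- ˇB : all initial segments (including themselves) of elements of B.
_∈ˇ_ : Node → List Node → Set
x ∈ˇ B = Any (λ b → x ⊑ b) B

-- An embedding of T_d = (2^{≤d}, ≺) into (ˇB, ≺).
Embeds : ℕ → List Node → Set
Embeds d B = Σ (Node → Node) λ f →
  (∀ a → length a ℕ.≤ d → f a ∈ˇ B)
  × (∀ a a' → length a ℕ.≤ d → length a' ℕ.≤ d → f a ≡ f a' → a ≡ a')
  × (∀ a a' → length a ℕ.≤ d → length a' ℕ.≤ d → (a ≺ a') ⇔ (f a ≺ f a'))

IsTD : List Node → ℤ → Set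
IsTD B t =
  (B ≡ [] × t ≡ -[1+ 0 ])
  ⊎ ((¬ B ≡ []) × Σ ℕ λ d → (t ≡ + d) × Embeds d B × (∀ d' → Embeds d' B → d' ℕ.≤ d))

-- Swaps are automorphisms of the full binary tree, so normalization does not change which T_d embed
-- in the initial segments of B; it remains to show TD(B̈) = ‖B̈‖.
-- If T_d embeds, follow its image downwards: the images of two siblings are incomparable extensions of
-- the image of their parent, and as the extensions without 1's form a chain, one of them carries an
-- extra 1. This yields a node of norm at least d.
-- Conversely, a subtree S is root normal, ‖S‖ ≤ ‖σ_∅(S)‖, iff its right half is no heavier than its left
-- half. Then either the left half alone attains ‖S‖, or both halves have norm ‖S‖ − 1 and embeddings of
-- T_{‖S‖−1} into them glue to one of T_{‖S‖}; by induction on the depth, T_{‖B̈‖} embeds once every subtree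
-- of B̈ is root normal. Processing deeper nodes first achieves this, since a swap at a only relabels the
-- subtrees strictly below a, which have all been processed already.

module Submission where

open import Defs
open import Data.Bool using (Bool; true; false; not; if_then_else_; T)
import Data.Bool.Properties as BoolP
open import Data.Nat as ℕ using (ℕ; zero; suc; _+_; z≤n; s≤s)
import Data.Nat.Properties as ℕP
open import Data.Integer as ℤ using (ℤ; +_; -[1+_]; _⊔_; _≤ᵇ_)
import Data.Integer.Properties as ℤP
open import Data.List using (List; []; _∷_; _++_; _∷ʳ_; map; foldl; length; lookup)
import Data.List.Properties as LP
open import Data.List.Relation.Unary.Any using (here; there)
import Data.List.Relation.Unary.Any as Any
import Data.List.Relation.Unary.Any.Properties as AnyP
open import Data.List.Relation.Unary.All using (All; []; _∷_)
import Data.List.Relation.Unary.All as All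
import Data.List.Relation.Unary.All.Properties as AllP
open import Data.List.Relation.Unary.AllPairs using (AllPairs; []; _∷_)
open import Data.List.Membership.Propositional using (_∉_)
open import Data.Fin as Fin using (Fin)
open import Data.Product using (Σ; _×_; _,_; proj₁; proj₂)
open import Data.Sum using (_⊎_; inj₁; inj₂)
open import Data.Empty using (⊥-elim)
open import Data.Unit using (tt)
open import Function using (_∘_)
open import Function.Construct.Composition using (_⇔-∘_)
open import Function.Construct.Identity using (⇔-id)
open import Function.Construct.Symmetry using (⇔-sym)
open import Function.Bundles using (_⇔_; mk⇔; Equivalence)
open import Relation.Binary.Definitions using (tri<; tri≈; tri>)
open import Relation.Nullary using (¬_; Dec; yes; no)
open import Relation.Binary.PropositionalEquality

open Equivalence using (to; from)

-- Prefixes and swaps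

_≟_ : (x y : Node) → Dec (x ≡ y)
_≟_ = LP.≡-dec BoolP._≟_

≺⇒⊑ : ∀ {x y} → x ≺ y → x ⊑ y
≺⇒⊑ (e , _ , eq) = e , eq

≺-irrefl : ∀ {x} → ¬ x ≺ x
≺-irrefl {x} (e , e≢[] , eq) = e≢[] (LP.++-identityʳ-unique x eq)

⊑⇒≺⊎≡ : ∀ {x y} → x ⊑ y → x ≺ y ⊎ x ≡ y
⊑⇒≺⊎≡ {x} ([] , eq) = inj₂ (sym (trans eq (LP.++-identityʳ x)))
⊑⇒≺⊎≡ (b ∷ e , eq) = inj₁ (b ∷ e , (λ ()) , eq)

⊑∧≢⇒≺ : ∀ {x y} → x ⊑ y → x ≢ y → x ≺ y
⊑∧≢⇒≺ x⊑y x≢y with ⊑⇒≺⊎≡ x⊑y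
... | inj₁ x≺y = x≺y
... | inj₂ x≡y = ⊥-elim (x≢y x≡y)

∷-≺-∷ : ∀ {b c x y} → (b ∷ x) ≺ (c ∷ y) → b ≡ c × x ≺ y
∷-≺-∷ (e , e≢[] , eq) = sym (LP.∷-injectiveˡ eq) , e , e≢[] , LP.∷-injectiveʳ eq

∷-≺⇔ : ∀ b {x y} → x ≺ y ⇔ (b ∷ x) ≺ (b ∷ y)
∷-≺⇔ b = mk⇔ (λ (e , e≢[] , eq) → e , e≢[] , cong (b ∷_) eq) (proj₂ ∘ ∷-≺-∷)

++⁺-⊑ : ∀ u {v w} → v ⊑ w → (u ++ v) ⊑ (u ++ w)
++⁺-⊑ u {v} (e , refl) = e , sym (LP.++-assoc u v e)

∷ʳ-⊑-∷ʳ : ∀ y {b c} → (y ∷ʳ b) ⊑ (y ∷ʳ c) → b ≡ c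
∷ʳ-⊑-∷ʳ [] (e , eq) = sym (LP.∷-injectiveˡ eq)
∷ʳ-⊑-∷ʳ (_ ∷ y) (e , eq) = ∷ʳ-⊑-∷ʳ y (e , LP.∷-injectiveʳ eq)

length-∷ʳ : ∀ (y : Node) b → length (y ∷ʳ b) ≡ suc (length y)
length-∷ʳ y b = trans (LP.length-++ y) (ℕP.+-comm (length y) 1)

swap-length : ∀ a x → length (swap a x) ≡ length x
swap-length [] [] = refl
swap-length [] (b ∷ x) = refl
swap-length (c ∷ a) [] = refl
swap-length (false ∷ a) (false ∷ x) = cong suc (swap-length a x)
swap-length (false ∷ a) (true ∷ x) = refl
swap-length (true ∷ a) (false ∷ x) = refl
swap-length (true ∷ a) (true ∷ x) = cong suc (swap-length a x)

swap-involutive : ∀ a x → swap a (swap a x) ≡ x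
swap-involutive [] [] = refl
swap-involutive [] (b ∷ x) = cong (_∷ x) (BoolP.not-involutive b)
swap-involutive (c ∷ a) [] = refl
swap-involutive (false ∷ a) (false ∷ x) = cong (false ∷_) (swap-involutive a x)
swap-involutive (false ∷ a) (true ∷ x) = refl
swap-involutive (true ∷ a) (false ∷ x) = refl
swap-involutive (true ∷ a) (true ∷ x) = cong (true ∷_) (swap-involutive a x)

swap-injective : ∀ a {x y} → swap a x ≡ swap a y → x ≡ y
swap-injective a {x} {y} eq =
  trans (sym (swap-involutive a x)) (trans (cong (swap a) eq) (swap-involutive a y))

swap-++ : ∀ a x e → Σ Node λ e' → swap a (x ++ e) ≡ swap a x ++ e'
swap-++ [] [] e = swap [] e , refl
swap-++ [] (b ∷ x) e = e , refl
swap-++ (c ∷ a) [] e = swap (c ∷ a) e , refl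
swap-++ (false ∷ a) (false ∷ x) e = let (e' , eq) = swap-++ a x e in e' , cong (false ∷_) eq
swap-++ (false ∷ a) (true ∷ x) e = e , refl
swap-++ (true ∷ a) (false ∷ x) e = e , refl
swap-++ (true ∷ a) (true ∷ x) e = let (e' , eq) = swap-++ a x e in e' , cong (true ∷_) eq

swap-preserves-⊑ : ∀ a {x y} → x ⊑ y → swap a x ⊑ swap a y
swap-preserves-⊑ a {x} (e , refl) = swap-++ a x e

swap-preserves-≺ : ∀ a {x y} → x ≺ y → swap a x ≺ swap a y
swap-preserves-≺ a {x} x≺y =
  ⊑∧≢⇒≺ (swap-preserves-⊑ a (≺⇒⊑ x≺y)) (λ eq → ≺-irrefl (subst (x ≺_) (sym (swap-injective a eq)) x≺y))

swap-reflects-≺ : ∀ a {x y} → swap a x ≺ swap a y → x ≺ y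
swap-reflects-≺ a {x} {y} h =
  subst₂ _≺_ (swap-involutive a x) (swap-involutive a y) (swap-preserves-≺ a h)

map-swap-involutive : ∀ a (B : List Node) → map (swap a) (map (swap a) B) ≡ B
map-swap-involutive a B =
  trans (sym (LP.map-∘ B)) (trans (LP.map-cong (swap-involutive a) B) (LP.map-id B))

map-swap-length : ∀ {n} a {B} → All (λ x → length x ≡ n) B → All (λ x → length x ≡ n) (map (swap a) B)
map-swap-length a = AllP.map⁺ ∘ All.map (λ {x} → trans (swap-length a x))

Embeds-∘ : ∀ {d B B'} (g : Node → Node) →
  (∀ {x} → x ∈ˇ B → g x ∈ˇ B') → (∀ {x y} → g x ≡ g y → x ≡ y) →
  (∀ {x y} → x ≺ y ⇔ g x ≺ g y) → Embeds d B → Embeds d B'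
Embeds-∘ g g-∈ˇ g-inj g-≺ (f , f-∈ˇ , f-inj , f-≺) =
  g ∘ f ,
  (λ a la → g-∈ˇ (f-∈ˇ a la)) ,
  (λ a a' la la' eq → f-inj a a' la la' (g-inj eq)) ,
  (λ a a' la la' → mk⇔ (to g-≺ ∘ to (f-≺ a a' la la')) (from (f-≺ a a' la la') ∘ from g-≺))

Embeds-map-swap : ∀ {d B} a → Embeds d B → Embeds d (map (swap a) B)
Embeds-map-swap a = Embeds-∘ (swap a)
  (AnyP.map⁺ ∘ Any.map (swap-preserves-⊑ a)) (swap-injective a)
  (mk⇔ (swap-preserves-≺ a) (swap-reflects-≺ a))

Embeds-map-swap⇔ : ∀ {d} a B → Embeds d (map (swap a) B) ⇔ Embeds d B
Embeds-map-swap⇔ {d} a B =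
  mk⇔ (subst (Embeds d) (map-swap-involutive a B) ∘ Embeds-map-swap a) (Embeds-map-swap a)

-- The normalization step

child : Bool → List Node → List Node
child b [] = []
child b ([] ∷ B) = child b B
child false ((false ∷ x) ∷ B) = x ∷ child false B
child false ((true ∷ x) ∷ B) = child false B
child true ((false ∷ x) ∷ B) = child true B
child true ((true ∷ x) ∷ B) = x ∷ child true B

subtree : Node → List Node → List Node
subtree [] B = B
subtree (b ∷ c) B = subtree c (child b B)

RootNormal : List Node → Set
RootNormal S = normSet S ℤ.≤ normSet (map (swap []) S)

restrict-[] : ∀ B → restrict [] B ≡ B
restrict-[] [] = refl
restrict-[] (x ∷ B) = cong (x ∷_) (restrict-[] B)

restrict-∷ : ∀ b a B → restrict (b ∷ a) B ≡ map (b ∷_) (restrict a (child b B))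
restrict-∷ b a [] = refl
restrict-∷ b a ([] ∷ B) = restrict-∷ b a B
restrict-∷ false a ((false ∷ x) ∷ B) with isPrefixᵇ a x
... | true = cong ((false ∷ x) ∷_) (restrict-∷ false a B)
... | false = restrict-∷ false a B
restrict-∷ false a ((true ∷ x) ∷ B) = restrict-∷ false a B
restrict-∷ true a ((false ∷ x) ∷ B) = restrict-∷ true a B
restrict-∷ true a ((true ∷ x) ∷ B) with isPrefixᵇ a x
... | true = cong ((true ∷ x) ∷_) (restrict-∷ true a B)
... | false = restrict-∷ true a B

-- Prepending a 1 raises the norm of a nonempty set by one; -1 encodes the empty set.
shift : ℤ → ℤ
shift (+ k) = + suc k
shift -[1+ k ] = -[1+ k ]

shift-⊔ : ∀ i j → shift (i ⊔ j) ≡ shift i ⊔ shift j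
shift-⊔ (+ m) (+ n) = refl
shift-⊔ (+ m) -[1+ n ] = refl
shift-⊔ -[1+ m ] (+ n) = refl
shift-⊔ -[1+ m ] -[1+ n ] = refl

shift-≤ᵇ : ∀ i j → (shift i ≤ᵇ shift j) ≡ (i ≤ᵇ j)
shift-≤ᵇ (+ zero) (+ n) = refl
shift-≤ᵇ (+ suc m) (+ n) = refl
shift-≤ᵇ (+ m) -[1+ n ] = refl
shift-≤ᵇ -[1+ m ] (+ n) = refl
shift-≤ᵇ -[1+ m ] -[1+ n ] = refl

normSet-map-false : ∀ L → normSet (map (false ∷_) L) ≡ normSet L
normSet-map-false [] = refl
normSet-map-false (x ∷ L) = cong (+ ‖ x ‖ ⊔_) (normSet-map-false L)

normSet-map-true : ∀ L → normSet (map (true ∷_) L) ≡ shift (normSet L)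
normSet-map-true [] = refl
normSet-map-true (x ∷ L) =
  trans (cong (+ suc ‖ x ‖ ⊔_) (normSet-map-true L)) (sym (shift-⊔ (+ ‖ x ‖) (normSet L)))

normSet-map-∷-≤ᵇ : ∀ b L L' →
  (normSet (map (b ∷_) L) ≤ᵇ normSet (map (b ∷_) L')) ≡ (normSet L ≤ᵇ normSet L')
normSet-map-∷-≤ᵇ false L L' = cong₂ _≤ᵇ_ (normSet-map-false L) (normSet-map-false L')
normSet-map-∷-≤ᵇ true L L' =
  trans (cong₂ _≤ᵇ_ (normSet-map-true L) (normSet-map-true L')) (shift-≤ᵇ (normSet L) (normSet L'))

swap-∷ : ∀ b a x → swap (b ∷ a) (b ∷ x) ≡ b ∷ swap a x
swap-∷ false a x = refl
swap-∷ true a x = refl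

map-swap-∷ : ∀ b a L → map (swap (b ∷ a)) (map (b ∷_) L) ≡ map (b ∷_) (map (swap a) L)
map-swap-∷ b a L = trans (sym (LP.map-∘ L)) (trans (LP.map-cong (swap-∷ b a) L) (LP.map-∘ L))

-- The step's test ‖B↾a‖ ≤ ‖σ_a(B↾a)‖ is root normality of the subtree at a.
step-test≡ : ∀ a B →
  (normSet (restrict a B) ≤ᵇ normSet (map (swap a) (restrict a B)))
    ≡ (normSet (subtree a B) ≤ᵇ normSet (map (swap []) (subtree a B)))
step-test≡ [] B = cong (λ S → normSet S ≤ᵇ normSet (map (swap []) S)) (restrict-[] B)
step-test≡ (b ∷ a) B = begin
    normSet (restrict (b ∷ a) B) ≤ᵇ normSet (map (swap (b ∷ a)) (restrict (b ∷ a) B))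
      ≡⟨ cong (λ S → normSet S ≤ᵇ normSet (map (swap (b ∷ a)) S)) (restrict-∷ b a B) ⟩
    normSet (map (b ∷_) R) ≤ᵇ normSet (map (swap (b ∷ a)) (map (b ∷_) R))
      ≡⟨ cong (λ S → normSet (map (b ∷_) R) ≤ᵇ normSet S) (map-swap-∷ b a R) ⟩
    normSet (map (b ∷_) R) ≤ᵇ normSet (map (b ∷_) (map (swap a) R))
      ≡⟨ normSet-map-∷-≤ᵇ b R (map (swap a) R) ⟩
    normSet R ≤ᵇ normSet (map (swap a) R)
      ≡⟨ step-test≡ a (child b B) ⟩
    normSet (subtree a (child b B)) ≤ᵇ normSet (map (swap []) (subtree a (child b B))) ∎
  where
  open ≡-Reasoning
  R = restrict a (child b B)

if-cases : ∀ {A : Set} b (x y : A) →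
  (T b × (if b then x else y) ≡ x) ⊎ (¬ T b × (if b then x else y) ≡ y)
if-cases true x y = inj₁ (tt , refl)
if-cases false x y = inj₂ ((λ ()) , refl)

step-cases : ∀ a B →
  (RootNormal (subtree a B) × step B a ≡ B) ⊎ (¬ RootNormal (subtree a B) × step B a ≡ map (swap a) B)
step-cases a B
  with if-cases (normSet (restrict a B) ≤ᵇ normSet (map (swap a) (restrict a B))) B (map (swap a) B)
... | inj₁ (test , eq) = inj₁ (ℤP.≤ᵇ⇒≤ (subst T (step-test≡ a B) test) , eq)
... | inj₂ (¬test , eq) = inj₂ (¬test ∘ subst T (sym (step-test≡ a B)) ∘ ℤP.≤⇒≤ᵇ , eq)

normalize-preserves : (P : List Node → Set) → (∀ a {B} → P B → P (map (swap a) B)) →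
  ∀ as {B} → P B → P (normalize as B)
normalize-preserves P P-swap [] p = p
normalize-preserves P P-swap (a ∷ as) {B} p with step-cases a B
... | inj₁ (_ , eq) = normalize-preserves P P-swap as (subst P (sym eq) p)
... | inj₂ (_ , eq) = normalize-preserves P P-swap as (subst P (sym eq) (P-swap a p))

normalize-[] : ∀ as → normalize as [] ≡ []
normalize-[] as = normalize-preserves (_≡ []) (λ a → cong (map (swap a))) as refl

normalize-nonempty : ∀ as {B} → B ≢ [] → normalize as B ≢ []
normalize-nonempty = normalize-preserves (_≢ []) map-swap-nonempty
  where
  map-swap-nonempty : ∀ a {C} → C ≢ [] → map (swap a) C ≢ []
  map-swap-nonempty a {[]} C≢[] _ = C≢[] refl
  map-swap-nonempty a {_ ∷ _} _ ()

Embeds-normalize : ∀ {d} as B → Embeds d (normalize as B) ⇔ Embeds d B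
Embeds-normalize {d} as B =
  normalize-preserves (λ C → Embeds d C ⇔ Embeds d B)
    (λ a {C} C⇔B → C⇔B ⇔-∘ Embeds-map-swap⇔ a C) as (⇔-id _)

-- Upper bound

norm-++ : ∀ (u x : Node) → ‖ u ++ x ‖ ≡ ‖ u ‖ + ‖ x ‖
norm-++ [] x = refl
norm-++ (true ∷ u) x = cong suc (norm-++ u x)
norm-++ (false ∷ u) x = norm-++ u x

norm-<-++ : ∀ u x → ‖ x ‖ ≢ 0 → ‖ u ‖ ℕ.< ‖ u ++ x ‖
norm-<-++ u x ‖x‖≢0 = subst (‖ u ‖ ℕ.<_) (sym (norm-++ u x)) (ℕP.m<m+n ‖ u ‖ (ℕP.n≢0⇒n>0 ‖x‖≢0))

norm≡0⇒⊑-total : ∀ {v w} → ‖ v ‖ ≡ 0 → ‖ w ‖ ≡ 0 → v ⊑ w ⊎ w ⊑ v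
norm≡0⇒⊑-total {[]} {w} _ _ = inj₁ (w , refl)
norm≡0⇒⊑-total {b ∷ v} {[]} _ _ = inj₂ (b ∷ v , refl)
norm≡0⇒⊑-total {true ∷ v} {_ ∷ w} () _
norm≡0⇒⊑-total {false ∷ v} {true ∷ w} _ ()
norm≡0⇒⊑-total {false ∷ v} {false ∷ w} p q with norm≡0⇒⊑-total {v} {w} p q
... | inj₁ (e , eq) = inj₁ (e , cong (false ∷_) eq)
... | inj₂ (e , eq) = inj₂ (e , cong (false ∷_) eq)

incomparable-extensions : ∀ {u v w} → u ⊑ v → u ⊑ w → ¬ v ⊑ w → ¬ w ⊑ v →
  ‖ u ‖ ℕ.< ‖ v ‖ ⊎ ‖ u ‖ ℕ.< ‖ w ‖
incomparable-extensions {u} (v' , refl) (w' , refl) v⋢w w⋢v with ‖ v' ‖ ℕ.≟ 0 | ‖ w' ‖ ℕ.≟ 0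
... | no ‖v'‖≢0 | _ = inj₁ (norm-<-++ u v' ‖v'‖≢0)
... | yes _ | no ‖w'‖≢0 = inj₂ (norm-<-++ u w' ‖w'‖≢0)
... | yes ‖v'‖≡0 | yes ‖w'‖≡0 with norm≡0⇒⊑-total ‖v'‖≡0 ‖w'‖≡0
...   | inj₁ v'⊑w' = ⊥-elim (v⋢w (++⁺-⊑ u v'⊑w'))
...   | inj₂ w'⊑v' = ⊥-elim (w⋢v (++⁺-⊑ u w'⊑v'))

image-reflects-⊑ : ∀ {d B} (E : Embeds d B) {x y} → length x ℕ.≤ d → length y ℕ.≤ d →
  proj₁ E x ⊑ proj₁ E y → x ⊑ y
image-reflects-⊑ (f , _ , f-inj , f-≺) {x} {y} lx ly fx⊑fy with ⊑⇒≺⊎≡ fx⊑fy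
... | inj₁ fx≺fy = ≺⇒⊑ (from (f-≺ x y lx ly) fx≺fy)
... | inj₂ fx≡fy = [] , trans (sym (f-inj x y lx ly fx≡fy)) (sym (LP.++-identityʳ x))

deep-image : ∀ {d B} (E : Embeds d B) k → k ℕ.≤ d →
  Σ Node λ y → length y ≡ k × k ℕ.≤ ‖ proj₁ E y ‖
deep-image E zero _ = [] , refl , z≤n
deep-image {d} E@(f , _ , _ , f-≺) (suc k) k<d with deep-image E k (ℕP.<⇒≤ k<d)
... | y , refl , k≤‖fy‖ =
  pick (incomparable-extensions (image false) (image true)
         (incomparable false true (λ ())) (incomparable true false (λ ())))
  where
  length-child : ∀ b → length (y ∷ʳ b) ℕ.≤ d
  length-child b = subst (ℕ._≤ d) (sym (length-∷ʳ y b)) k<d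
  image : ∀ b → f y ⊑ f (y ∷ʳ b)
  image b = ≺⇒⊑ (to (f-≺ y (y ∷ʳ b) (ℕP.<⇒≤ k<d) (length-child b)) (b ∷ [] , (λ ()) , refl))
  incomparable : ∀ b c → b ≢ c → ¬ f (y ∷ʳ b) ⊑ f (y ∷ʳ c)
  incomparable b c b≢c = b≢c ∘ ∷ʳ-⊑-∷ʳ y ∘ image-reflects-⊑ E (length-child b) (length-child c)
  deeper : ∀ b → ‖ f y ‖ ℕ.< ‖ f (y ∷ʳ b) ‖ →
    Σ Node λ y' → length y' ≡ suc (length y) × suc (length y) ℕ.≤ ‖ f y' ‖
  deeper b lt = y ∷ʳ b , length-∷ʳ y b , ℕP.≤-<-trans k≤‖fy‖ lt
  pick : ‖ f y ‖ ℕ.< ‖ f (y ∷ʳ false) ‖ ⊎ ‖ f y ‖ ℕ.< ‖ f (y ∷ʳ true) ‖ →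
    Σ Node λ y' → length y' ≡ suc (length y) × suc (length y) ℕ.≤ ‖ f y' ‖
  pick (inj₁ lt) = deeper false lt
  pick (inj₂ lt) = deeper true lt

normSet-∈ˇ : ∀ {x} B → x ∈ˇ B → + ‖ x ‖ ℤ.≤ normSet B
normSet-∈ˇ {x} (.(x ++ e) ∷ B) (here (e , refl)) =
  ℤP.≤-trans (ℤ.+≤+ (subst (‖ x ‖ ℕ.≤_) (sym (norm-++ x e)) (ℕP.m≤m+n ‖ x ‖ ‖ e ‖)))
             (ℤP.i≤i⊔j (+ ‖ x ++ e ‖) (normSet B))
normSet-∈ˇ (b ∷ B) (there x∈ˇB) = ℤP.≤-trans (normSet-∈ˇ B x∈ˇB) (ℤP.i≤j⊔i (+ ‖ b ‖) (normSet B))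

Embeds⇒≤normSet : ∀ {d B} → Embeds d B → + d ℤ.≤ normSet B
Embeds⇒≤normSet {d} {B} E@(f , f-∈ˇ , _ , _) with deep-image E d ℕP.≤-refl
... | y , ly , d≤‖fy‖ = ℤP.≤-trans (ℤ.+≤+ d≤‖fy‖) (normSet-∈ˇ B (f-∈ˇ y (ℕP.≤-reflexive ly)))

-- Normalized sets

child-map-swap-[] : ∀ b B → child b (map (swap []) B) ≡ child (not b) B
child-map-swap-[] b [] = refl
child-map-swap-[] b ([] ∷ B) = child-map-swap-[] b B
child-map-swap-[] false ((false ∷ x) ∷ B) = child-map-swap-[] false B
child-map-swap-[] false ((true ∷ x) ∷ B) = cong (x ∷_) (child-map-swap-[] false B)
child-map-swap-[] true ((false ∷ x) ∷ B) = cong (x ∷_) (child-map-swap-[] true B)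
child-map-swap-[] true ((true ∷ x) ∷ B) = child-map-swap-[] true B

child-map-swap-∷ : ∀ b a B → child b (map (swap (b ∷ a)) B) ≡ map (swap a) (child b B)
child-map-swap-∷ b a [] = refl
child-map-swap-∷ b a ([] ∷ B) = child-map-swap-∷ b a B
child-map-swap-∷ false a ((false ∷ x) ∷ B) = cong (swap a x ∷_) (child-map-swap-∷ false a B)
child-map-swap-∷ false a ((true ∷ x) ∷ B) = child-map-swap-∷ false a B
child-map-swap-∷ true a ((false ∷ x) ∷ B) = child-map-swap-∷ true a B
child-map-swap-∷ true a ((true ∷ x) ∷ B) = cong (swap a x ∷_) (child-map-swap-∷ true a B)

child-not-map-swap-∷ : ∀ b a B → child (not b) (map (swap (b ∷ a)) B) ≡ child (not b) B
child-not-map-swap-∷ b a [] = refl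
child-not-map-swap-∷ b a ([] ∷ B) = child-not-map-swap-∷ b a B
child-not-map-swap-∷ false a ((false ∷ x) ∷ B) = child-not-map-swap-∷ false a B
child-not-map-swap-∷ false a ((true ∷ x) ∷ B) = cong (x ∷_) (child-not-map-swap-∷ false a B)
child-not-map-swap-∷ true a ((false ∷ x) ∷ B) = cong (x ∷_) (child-not-map-swap-∷ true a B)
child-not-map-swap-∷ true a ((true ∷ x) ∷ B) = child-not-map-swap-∷ true a B

subtree-map-swap-self : ∀ a B → subtree a (map (swap a) B) ≡ map (swap []) (subtree a B)
subtree-map-swap-self [] B = refl
subtree-map-swap-self (b ∷ a) B =
  trans (cong (subtree a) (child-map-swap-∷ b a B)) (subtree-map-swap-self a (child b B))

subtree-map-swap : ∀ a c B → length a ℕ.≤ length c → a ≢ c →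
  (length a ℕ.< length c × subtree c (map (swap a) B) ≡ subtree (swap a c) B)
  ⊎ subtree c (map (swap a) B) ≡ subtree c B
subtree-map-swap [] [] B _ a≢c = ⊥-elim (a≢c refl)
subtree-map-swap [] (b ∷ c) B _ _ = inj₁ (s≤s z≤n , cong (subtree c) (child-map-swap-[] b B))
subtree-map-swap (false ∷ a) (true ∷ c) B _ _ = inj₂ (cong (subtree c) (child-not-map-swap-∷ false a B))
subtree-map-swap (true ∷ a) (false ∷ c) B _ _ = inj₂ (cong (subtree c) (child-not-map-swap-∷ true a B))
subtree-map-swap (false ∷ a) (false ∷ c) B (s≤s la≤lc) a≢c
  with subtree-map-swap a c (child false B) la≤lc (a≢c ∘ cong (false ∷_))
... | inj₁ (la<lc , eq) = inj₁ (s≤s la<lc , trans (cong (subtree c) (child-map-swap-∷ false a B)) eq)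
... | inj₂ eq = inj₂ (trans (cong (subtree c) (child-map-swap-∷ false a B)) eq)
subtree-map-swap (true ∷ a) (true ∷ c) B (s≤s la≤lc) a≢c
  with subtree-map-swap a c (child true B) la≤lc (a≢c ∘ cong (true ∷_))
... | inj₁ (la<lc , eq) = inj₁ (s≤s la<lc , trans (cong (subtree c) (child-map-swap-∷ true a B)) eq)
... | inj₂ eq = inj₂ (trans (cong (subtree c) (child-map-swap-∷ true a B)) eq)

RootNormal-map-swap : ∀ S → ¬ RootNormal S → RootNormal (map (swap []) S)
RootNormal-map-swap S ¬normal =
  subst (λ S' → normSet (map (swap []) S) ℤ.≤ normSet S') (sym (map-swap-involutive [] S))
        (ℤP.<⇒≤ (ℤP.≰⇒> ¬normal))

step-normalises : ∀ a B → RootNormal (subtree a (step B a))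
step-normalises a B with step-cases a B
... | inj₁ (normal , eq) = subst (RootNormal ∘ subtree a) (sym eq) normal
... | inj₂ (¬normal , eq) =
  subst (RootNormal ∘ subtree a) (sym eq)
        (subst RootNormal (sym (subtree-map-swap-self a B)) (RootNormal-map-swap (subtree a B) ¬normal))

step-preserves-normal : ∀ {a c} B → length a ℕ.≤ length c → a ≢ c →
  RootNormal (subtree c B) → (length a ℕ.< length c → RootNormal (subtree (swap a c) B)) →
  RootNormal (subtree c (step B a))
step-preserves-normal {a} {c} B la≤lc a≢c normal-c normal-swap-c with step-cases a B
... | inj₁ (_ , eq) = subst (RootNormal ∘ subtree c) (sym eq) normal-c
... | inj₂ (_ , eq) with subtree-map-swap a c B la≤lc a≢c
...   | inj₁ (la<lc , eq') =
  subst (RootNormal ∘ subtree c) (sym eq) (subst RootNormal (sym eq') (normal-swap-c la<lc))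
...   | inj₂ eq' = subst (RootNormal ∘ subtree c) (sym eq) (subst RootNormal (sym eq') normal-c)

ordered⇒descending : ∀ (as : List Node) →
  (∀ (i j : Fin (length as)) → length (lookup as j) ℕ.< length (lookup as i) → i Fin.< j) →
  AllPairs (λ a c → length c ℕ.≤ length a) as
ordered⇒descending [] _ = []
ordered⇒descending (a ∷ as) ordered =
  All.tabulate (λ c∈as → ℕP.≮⇒≥ λ la<lc → suc≮zero (ordered (Fin.suc (Any.index c∈as)) Fin.zero
                  (subst (λ c → length a ℕ.< length c) (AnyP.lookup-index c∈as) la<lc)))
  ∷ ordered⇒descending as (λ i j lt → ℕ.s≤s⁻¹ (ordered (Fin.suc i) (Fin.suc j) lt))
  where
  suc≮zero : ∀ {k} → ¬ Fin.suc k Fin.< Fin.zero {length as}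
  suc≮zero ()

-- Loop invariant: processed nodes are root normal, and no pending node is deeper than a processed one.
module _ (n : ℕ) where

  Settled : List Node → Node → Set
  Settled pending c = length c ℕ.< n × c ∉ pending

  foldl-step-normal : ∀ pending B → AllPairs (λ a c → length c ℕ.≤ length a) pending →
    (∀ {c} → Settled pending c → All (λ a → length a ℕ.≤ length c) pending) →
    (∀ {c} → Settled pending c → RootNormal (subtree c B)) →
    ∀ c → length c ℕ.< n → RootNormal (subtree c (foldl step B pending))
  foldl-step-normal [] B _ _ normal c lc<n = normal {c} (lc<n , λ ())
  foldl-step-normal (a ∷ pending) B (a-deepest ∷ descending) shallower normal =
    foldl-step-normal pending (step B a) descending shallower' normal'
    where
    settled-before : ∀ {c} → Settled pending c → a ≢ c → Settled (a ∷ pending) c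
    settled-before (lc<n , c∉) a≢c = lc<n , λ { (here c≡a) → a≢c (sym c≡a) ; (there c∈) → c∉ c∈ }
    shallower' : ∀ {c} → Settled pending c → All (λ a' → length a' ℕ.≤ length c) pending
    shallower' {c} s with a ≟ c
    ... | yes refl = a-deepest
    ... | no a≢c = All.tail (shallower (settled-before s a≢c))
    normal' : ∀ {c} → Settled pending c → RootNormal (subtree c (step B a))
    normal' {c} s with a ≟ c
    ... | yes refl = step-normalises a B
    ... | no a≢c = step-preserves-normal B la≤lc a≢c (normal {c} (settled-before s a≢c)) normal-swap
      where
      la≤lc : length a ℕ.≤ length c
      la≤lc = All.head (shallower (settled-before s a≢c))
      normal-swap : length a ℕ.< length c → RootNormal (subtree (swap a c) B)
      normal-swap la<lc = normal {swap a c} (subst (ℕ._< n) (sym (swap-length a c)) (proj₁ s) , swap-c∉)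
        where
        swap-c∉ : swap a c ∉ a ∷ pending
        swap-c∉ (here eq) = ℕP.<-irrefl (trans (cong length (sym eq)) (swap-length a c)) la<lc
        swap-c∉ (there swap-c∈) =
          ℕP.<⇒≱ la<lc (subst (ℕ._≤ length a) (swap-length a c) (All.lookup a-deepest swap-c∈))

-- Lower bound

child-length : ∀ m b B → All (λ x → length x ≡ suc m) B → All (λ x → length x ≡ m) (child b B)
child-length m b [] [] = []
child-length m b ([] ∷ B) (() ∷ _)
child-length m false ((false ∷ x) ∷ B) (lx ∷ len) = ℕP.suc-injective lx ∷ child-length m false B len
child-length m false ((true ∷ x) ∷ B) (_ ∷ len) = child-length m false B len
child-length m true ((false ∷ x) ∷ B) (_ ∷ len) = child-length m true B len
child-length m true ((true ∷ x) ∷ B) (lx ∷ len) = ℕP.suc-injective lx ∷ child-length m true B len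

normSet-children : ∀ m B → All (λ x → length x ≡ suc m) B →
  normSet B ≡ normSet (child false B) ⊔ shift (normSet (child true B))
normSet-children m [] [] = refl
normSet-children m ([] ∷ B) (() ∷ _)
normSet-children m ((false ∷ x) ∷ B) (_ ∷ len) =
  trans (cong (+ ‖ x ‖ ⊔_) (normSet-children m B len)) (sym (ℤP.⊔-assoc (+ ‖ x ‖) _ _))
normSet-children m ((true ∷ x) ∷ B) (_ ∷ len) = begin
    + suc ‖ x ‖ ⊔ normSet B             ≡⟨ cong (+ suc ‖ x ‖ ⊔_) (normSet-children m B len) ⟩
    + suc ‖ x ‖ ⊔ (N₀ ⊔ shift N₁)       ≡⟨ sym (ℤP.⊔-assoc (+ suc ‖ x ‖) N₀ (shift N₁)) ⟩
    (+ suc ‖ x ‖ ⊔ N₀) ⊔ shift N₁       ≡⟨ cong (_⊔ shift N₁) (ℤP.⊔-comm (+ suc ‖ x ‖) N₀) ⟩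
    (N₀ ⊔ + suc ‖ x ‖) ⊔ shift N₁       ≡⟨ ℤP.⊔-assoc N₀ (+ suc ‖ x ‖) (shift N₁) ⟩
    N₀ ⊔ (+ suc ‖ x ‖ ⊔ shift N₁)       ≡⟨ cong (N₀ ⊔_) (sym (shift-⊔ (+ ‖ x ‖) N₁)) ⟩
    N₀ ⊔ shift (+ ‖ x ‖ ⊔ N₁)           ∎
  where
  open ≡-Reasoning
  N₀ = normSet (child false B)
  N₁ = normSet (child true B)

normSet-map-swap-children : ∀ m B → All (λ x → length x ≡ suc m) B →
  normSet (map (swap []) B) ≡ normSet (child true B) ⊔ shift (normSet (child false B))
normSet-map-swap-children m B len =
  trans (normSet-children m (map (swap []) B) (map-swap-length [] len))
        (cong₂ (λ S₀ S₁ → normSet S₀ ⊔ shift (normSet S₁))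
               (child-map-swap-[] false B) (child-map-swap-[] true B))

root-normal-cases : ∀ x y {r} → x ⊔ shift y ℤ.≤ y ⊔ shift x → x ⊔ shift y ≡ + r →
  x ≡ + r ⊎ Σ ℕ λ p → r ≡ suc p × x ≡ + p × y ≡ + p
root-normal-cases (+ p) -[1+ _ ] _ eq = inj₁ eq
root-normal-cases -[1+ _ ] (+ q) (ℤ.+≤+ q<q) _ = ⊥-elim (ℕP.n≮n q q<q)
root-normal-cases -[1+ _ ] -[1+ _ ] _ ()
root-normal-cases (+ p) (+ q) (ℤ.+≤+ le) eq with ℕP.<-cmp q p
... | tri< q<p _ _ = inj₁ (trans (cong +_ (sym (ℕP.m≥n⇒m⊔n≡m q<p))) eq)
... | tri≈ _ refl _ =
  inj₂ (p , trans (sym (ℤP.+-injective eq)) (ℕP.m≤n⇒m⊔n≡n (ℕP.n≤1+n p)) , refl , refl)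
... | tri> _ _ p<q = ⊥-elim (ℕP.n≮n q
        (subst₂ ℕ._≤_ (ℕP.m≤n⇒m⊔n≡n (ℕP.m≤n⇒m≤1+n (ℕP.<⇒≤ p<q))) (ℕP.m≥n⇒m⊔n≡m p<q) le))

child-∈ˇ : ∀ b {x} B → x ∈ˇ child b B → (b ∷ x) ∈ˇ B
child-∈ˇ b [] ()
child-∈ˇ b ([] ∷ B) x∈ˇ = there (child-∈ˇ b B x∈ˇ)
child-∈ˇ false ((false ∷ y) ∷ B) (here (e , eq)) = here (e , cong (false ∷_) eq)
child-∈ˇ false ((false ∷ y) ∷ B) (there x∈ˇ) = there (child-∈ˇ false B x∈ˇ)
child-∈ˇ false ((true ∷ y) ∷ B) x∈ˇ = there (child-∈ˇ false B x∈ˇ)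
child-∈ˇ true ((false ∷ y) ∷ B) x∈ˇ = there (child-∈ˇ true B x∈ˇ)
child-∈ˇ true ((true ∷ y) ∷ B) (here (e , eq)) = here (e , cong (true ∷_) eq)
child-∈ˇ true ((true ∷ y) ∷ B) (there x∈ˇ) = there (child-∈ˇ true B x∈ˇ)

Embeds-child : ∀ {r} b B → Embeds r (child b B) → Embeds r B
Embeds-child b B = Embeds-∘ (b ∷_) (child-∈ˇ b B) LP.∷-injectiveʳ (∷-≺⇔ b)

Embeds-zero : ∀ x B → Embeds 0 (x ∷ B)
Embeds-zero x B =
  (λ _ → []) ,
  (λ _ _ → here (x , refl)) ,
  (λ { [] [] _ _ _ → refl ; (_ ∷ _) _ () _ _ ; [] (_ ∷ _) _ () _ }) ,
  (λ { [] [] _ _ → ⇔-id _ ; (_ ∷ _) _ () _ ; [] (_ ∷ _) _ () })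

Embeds-glue : ∀ {p} B → ((b : Bool) → Embeds p (child b B)) → Embeds (suc p) B
Embeds-glue {p} B E = g , g-∈ˇ , g-inj , g-≺
  where
  f : Bool → Node → Node
  f b = proj₁ (E b)
  g : Node → Node
  g [] = []
  g (b ∷ x) = b ∷ f b x
  g-∈ˇ : ∀ a → length a ℕ.≤ suc p → g a ∈ˇ B
  g-∈ˇ [] _ = Any.map (λ {y} _ → y , refl) (child-∈ˇ false B (proj₁ (proj₂ (E false)) [] z≤n))
  g-∈ˇ (b ∷ x) (s≤s lx) = child-∈ˇ b B (proj₁ (proj₂ (E b)) x lx)
  g-inj : ∀ a a' → length a ℕ.≤ suc p → length a' ℕ.≤ suc p → g a ≡ g a' → a ≡ a'
  g-inj [] [] _ _ _ = refl
  g-inj [] (_ ∷ _) _ _ ()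
  g-inj (_ ∷ _) [] _ _ ()
  g-inj (b ∷ x) (c ∷ y) (s≤s lx) (s≤s ly) eq with LP.∷-injectiveˡ eq
  ... | refl = cong (b ∷_) (proj₁ (proj₂ (proj₂ (E b))) x y lx ly (LP.∷-injectiveʳ eq))
  g-≺ : ∀ a a' → length a ℕ.≤ suc p → length a' ℕ.≤ suc p → a ≺ a' ⇔ g a ≺ g a'
  g-≺ [] [] _ _ = ⇔-id _
  g-≺ [] (c ∷ y) _ _ = mk⇔ (λ _ → g (c ∷ y) , (λ ()) , refl) (λ _ → c ∷ y , (λ ()) , refl)
  g-≺ (_ ∷ _) [] _ _ = mk⇔ (λ { (_ , _ , ()) }) (λ { (_ , _ , ()) })
  g-≺ (b ∷ x) (c ∷ y) (s≤s lx) (s≤s ly) with b BoolP.≟ c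
  ... | yes refl = ∷-≺⇔ b ⇔-∘ (proj₂ (proj₂ (proj₂ (E b))) x y lx ly ⇔-∘ ⇔-sym (∷-≺⇔ b))
  ... | no b≢c = mk⇔ (⊥-elim ∘ b≢c ∘ proj₁ ∘ ∷-≺-∷) (⊥-elim ∘ b≢c ∘ proj₁ ∘ ∷-≺-∷)

normSet-depth-0 : ∀ x B → All (λ y → length y ≡ 0) (x ∷ B) → normSet (x ∷ B) ≡ + 0
normSet-depth-0 [] [] _ = refl
normSet-depth-0 [] (y ∷ B) (_ ∷ len) = cong (+ 0 ⊔_) (normSet-depth-0 y B len)
normSet-depth-0 (_ ∷ _) _ (() ∷ _)

Embeds-normSet : ∀ n B → All (λ x → length x ≡ n) B →
  (∀ c → length c ℕ.< n → RootNormal (subtree c B)) → ∀ {r} → normSet B ≡ + r → Embeds r B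
Embeds-normSet zero [] _ _ ()
Embeds-normSet zero (x ∷ B) len _ eq =
  subst (λ r → Embeds r (x ∷ B)) (ℤP.+-injective (trans (sym (normSet-depth-0 x B len)) eq))
        (Embeds-zero x B)
Embeds-normSet (suc m) B len normal {r} eq = by-cases (root-normal-cases N₀ N₁ root-normal eq')
  where
  N₀ = normSet (child false B)
  N₁ = normSet (child true B)
  root-normal : N₀ ⊔ shift N₁ ℤ.≤ N₁ ⊔ shift N₀
  root-normal =
    subst₂ ℤ._≤_ (normSet-children m B len) (normSet-map-swap-children m B len) (normal [] (s≤s z≤n))
  eq' : N₀ ⊔ shift N₁ ≡ + r
  eq' = trans (sym (normSet-children m B len)) eq
  in-child : ∀ b {r'} → normSet (child b B) ≡ + r' → Embeds r' (child b B)
  in-child b =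
    Embeds-normSet m (child b B) (child-length m b B len) (λ c lc<m → normal (b ∷ c) (s≤s lc<m))
  by-cases : N₀ ≡ + r ⊎ Σ ℕ (λ p → r ≡ suc p × N₀ ≡ + p × N₁ ≡ + p) → Embeds r B
  by-cases (inj₁ eq₀) = Embeds-child false B (in-child false eq₀)
  by-cases (inj₂ (p , r≡1+p , eq₀ , eq₁)) =
    subst (λ r' → Embeds r' B) (sym r≡1+p)
          (Embeds-glue B λ { false → in-child false eq₀ ; true → in-child true eq₁ })

+⊔-nonnegative : ∀ m i → Σ ℕ λ r → + m ⊔ i ≡ + r
+⊔-nonnegative m (+ k) = ℕ._⊔_ m k , refl
+⊔-nonnegative m -[1+ k ] = m , refl

normSet-nonempty : ∀ B → B ≢ [] → Σ ℕ λ r → normSet B ≡ + r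
normSet-nonempty [] B≢[] = ⊥-elim (B≢[] refl)
normSet-nonempty (x ∷ B) _ = +⊔-nonnegative ‖ x ‖ (normSet B)

theorem1p17 : (n : ℕ) (B : List Node) → All (λ b → length b ≡ n) B →
    (as : List Node) → IsEnumeration n as →
    IsTD B (normSet (normalize as B))
theorem1p17 n [] _ as _ = inj₁ (refl , cong normSet (normalize-[] as))
theorem1p17 n B@(_ ∷ _) len as (_ , complete , ordered)
  with normSet-nonempty (normalize as B) (normalize-nonempty as (λ ()))
... | r , eq = inj₂ ((λ ()) , r , eq , lower , upper)
  where
  B̈ = normalize as B
  nothing-settled : ∀ {c} → ¬ Settled n as c
  nothing-settled (lc<n , c∉as) = c∉as (from (complete _) lc<n)
  normal : ∀ c → length c ℕ.< n → RootNormal (subtree c B̈)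
  normal = foldl-step-normal n as B (ordered⇒descending as ordered)
    (⊥-elim ∘ nothing-settled) (⊥-elim ∘ nothing-settled)
  lower : Embeds r B
  lower = to (Embeds-normalize as B)
    (Embeds-normSet n B̈ (normalize-preserves (All (λ x → length x ≡ n)) map-swap-length as len)
                    normal eq)
  upper : ∀ d → Embeds d B → d ℕ.≤ r
  upper d E = ℤP.drop‿+≤+ (subst (+ d ℤ.≤_) eq (Embeds⇒≤normSet (from (Embeds-normalize as B) E)))
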